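{- Let $\alpha=\alpha(n)=O(n)$, let $p=p(n)$ be admissible, and for each $n$ let $t=t_n$ be an $\alpha$-almost supermagic edge labeling of $K_n$. Suppose that for each $n$ there is a partition of $[\epsilon]$ into $m=m(n)$ 1-APs $I_1,\dots,I_m$ with $m=o(n^2/p)$, such that for every vertex $v$ and every $i\in[m]$, $|I_i\cap S(t,v)|\le 1$. Then $r(p,t)=1$.
   Context: $K_n$ is the complete graph on $n$ vertices with edge set $E$, $\epsilon=\binom n2$, $[a]=\{1,\dots,a\}$; a 1-AP is a set of consecutive integers. $D(v)$ is the set of edges containing vertex $v$. An edge labeling is a bijection $t:E\to[\epsilon]$; $S(t,v)=\{t(e):e\in D(v)\}$, $s(t,v)=\sum_{e\in D(v)}t(e)$. $t$ is $\alpha$-almost supermagic if $|s(t,u)-s(t,v)|\le\alpha$ for all $u,v$. A $p$-swap of $t$ is a map $\theta$ sending $t$ to another edge labeling $\theta t$ with $|t(e)-\theta t(e)|\le p$ for all $e$. $R(p,t,n)=\max_{\theta}\max_{u\ne v}|s(\theta t,u)-s(\theta t,v)|$ over $p$-swaps $\theta$; $r(p,t)=\limsup_{n\to\infty}R(p,t_n,n)/(2pn)$. $p=p(n)$ is admissible if $p=o(n)$ and $p\to\infty$. -}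

module Defs where

open import Data.Nat using (ℕ; zero; suc; _+_; _*_; _≤_; ∣_-_∣)
open import Data.Nat.Combinatorics using (_C_)
open import Data.Fin as F using (Fin; toℕ)
open import Data.Fin.Properties using (<-cmp)
open import Data.List using (List; map; allFin)
open import Data.Nat.ListAction using (sum)
open import Data.Product using (Σ; ∃; _×_; _,_; proj₁; proj₂)
open import Data.Sum using (_⊎_)
open import Relation.Binary.PropositionalEquality using (_≡_; _≢_)
open import Relation.Binary.Definitions using (tri<; tri≈; tri>)

-- Edges of K_n: unordered pairs {i,j}, i ≠ j, represented as (i , j) with i < j.
Edge : ℕ → Set
Edge n = Σ (Fin n × Fin n) (λ ij → proj₁ ij F.< proj₂ ij)

ε : ℕ → ℕ
ε n = n C 2

Incident : {n : ℕ} → Fin n → Edge n → Set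
Incident v ((i , j) , _) = (i ≡ v) ⊎ (j ≡ v)

record Labeling (n : ℕ) : Set where
  field
    lab   : Edge n → ℕ
    inj   : ∀ e e′ → lab e ≡ lab e′ → proj₁ e ≡ proj₁ e′
    range : ∀ e → 1 ≤ lab e × lab e ≤ ε n
    onto  : ∀ k → 1 ≤ k → k ≤ ε n → ∃ λ e → lab e ≡ k
open Labeling public

-- label of the edge {u,v} (0 if u = v, which is not an edge)
wt : {n : ℕ} → Labeling n → Fin n → Fin n → ℕ
wt t u v with <-cmp u v
... | tri< u<v _ _ = lab t ((u , v) , u<v)
... | tri≈ _ _ _   = 0
... | tri> _ _ v<u = lab t ((v , u) , v<u)

s : {n : ℕ} → Labeling n → Fin n → ℕ
s {n} t v = sum (map (λ u → wt t u v) (allFin n))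

AlmostSupermagic : {n : ℕ} → ℕ → Labeling n → Set
AlmostSupermagic {n} α t = ∀ (u v : Fin n) → ∣ s t u - s t v ∣ ≤ α

IsSwap : {n : ℕ} → ℕ → Labeling n → Labeling n → Set
IsSwap p t t′ = ∀ e → ∣ lab t e - lab t′ e ∣ ≤ p

-- A partition of [ε] into m 1-APs I_1..I_m, given by the block index
-- blk k ∈ Fin m of each k ∈ [ε]; each block {k ∈ [ε] : blk k ≡ i} is a set
-- of consecutive integers.
IntervalPartition : (n m : ℕ) → (ℕ → Fin m) → Set
IntervalPartition n m blk =
  ∀ a b c → 1 ≤ a → a ≤ b → b ≤ c → c ≤ ε n → blk a ≡ blk c → blk b ≡ blk a

-- |I_i ∩ S(t,v)| ≤ 1 for every v and i: distinct edges at a common vertex v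
-- get labels in distinct blocks.
Separated : {n m : ℕ} → Labeling n → (ℕ → Fin m) → Set
Separated {n} t blk =
  ∀ (v : Fin n) (e e′ : Edge n) → Incident v e → Incident v e′ →
    proj₁ e ≢ proj₁ e′ → blk (lab t e) ≢ blk (lab t e′)

BigOn : (ℕ → ℕ) → Set
BigOn f = ∃ λ C → ∃ λ N → ∀ n → N ≤ n → f n ≤ C * n

LittleOn : (ℕ → ℕ) → Set
LittleOn f = ∀ k → ∃ λ N → ∀ n → N ≤ n → k * f n ≤ n

TendsToInfinity : (ℕ → ℕ) → Set
TendsToInfinity f = ∀ M → ∃ λ N → ∀ n → N ≤ n → M ≤ f n

Admissible : (ℕ → ℕ) → Set
Admissible p = LittleOn p × TendsToInfinity p

LittleOn²/p : (m p : ℕ → ℕ) → Set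
LittleOn²/p m p = ∀ k → ∃ λ N → ∀ n → N ≤ n → k * m n * p n ≤ n * n

-- R(p,t,n) is a max over the finitely many p-swaps θ and pairs u ≠ v.
-- r(p,t) = limsup_n R(p,t_n,n)/(2 p n) = 1, written out with ε = 1/(k+1):
--  (i)  ∀k, eventually (k+1)·R ≤ (k+2)·2pn     (R/(2pn) ≤ 1 + 1/(k+1))
--  (ii) ∀k ∀N ∃n ≥ N, (k+1)·R ≥ k·2pn          (R/(2pn) ≥ 1 − 1/(k+1))
LimsupIsOne : (p : ℕ → ℕ) → ((n : ℕ) → Labeling n) → Set
LimsupIsOne p t =
  (∀ k → ∃ λ N → ∀ n → N ≤ n →
     ∀ (t′ : Labeling n) → IsSwap (p n) (t n) t′ →
     ∀ (u v : Fin n) → u ≢ v →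
       suc k * ∣ s t′ u - s t′ v ∣ ≤ (2 + k) * (2 * p n * n))
  ×
  (∀ k N → ∃ λ n → N ≤ n × Σ (Labeling n) λ t′ → IsSwap (p n) (t n) t′ ×
     Σ (Fin n) λ u → Σ (Fin n) λ v → u ≢ v ×
       k * (2 * p n * n) ≤ suc k * ∣ s t′ u - s t′ v ∣)

module Submission where

-- Upper bound: a p-swap moves every vertex sum by at most n p, so two vertex sums of a p-swap of t
-- differ by at most 2 p n + α = 2 p n + o(p n).
-- Lower bound: for vertices u ≠ v, exchange labels x ↔ x + p so that labels of u move up and labels
-- of v move down into free slots; then s(u) gains and s(v) loses p per label, except at obstructed
-- labels, each of which costs at most 2 p. A label is obstructed only if it or its p-neighbour is
-- shared with the other vertex, or it lies within p of an end of its 1-AP: a p-neighbour at the same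
-- vertex lies in another block by the separation hypothesis. Each label sits at two vertices, so the
-- near-end labels number at most 2 m p in total and averaging over u, then v, leaves
-- O(m p / n + 1) obstructions, costing O(m p² / n + p) = o(p n) since m = o(n² / p).

open import Defs
open import Data.Fin using (Fin; zero; suc)
open import Data.Fin.Properties as Fin using (any?)
open import Data.List using (List; []; _∷_; map; length; allFin; tabulate; applyDownFrom)
open import Data.List.Membership.Propositional using (_∈_)
open import Data.List.Membership.Propositional.Properties
  using (∈-allFin; ∈-applyDownFrom⁺; ∈-applyDownFrom⁻)
open import Data.List.Properties using (map-cong; map-tabulate; length-tabulate)
open import Data.List.Relation.Unary.Any using (here; there)
open import Data.Nat
  using (ℕ; zero; suc; _+_; _*_; _∸_; _≤_; _<_; z≤n; s≤s; s≤s⁻¹; _≤?_; _<?_; _≟_; ∣_-_∣; >-nonZero)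
open import Data.Nat.ListAction using (sum)
open import Data.Nat.Properties
open import Data.Nat.Tactic.RingSolver using (solve-∀)
open import Data.Product using (Σ; ∃; _×_; _,_; proj₁; proj₂; swap)
open import Data.Product.Properties using (,-injectiveˡ; ,-injectiveʳ; ,-injective)
open import Data.Sum using (_⊎_; inj₁; inj₂)
open import Function using (_∘_; id)
open import Level using (0ℓ)
open import Relation.Binary.Definitions using (tri<; tri≈; tri>)
open import Relation.Binary.PropositionalEquality
open import Relation.Nullary using (Dec; yes; no; ¬_; ¬?; contradiction; _×-dec_; _⊎-dec_)
open import Relation.Unary using (Pred; Decidable; _⊆_)
open import Relation.Unary.Properties using (∁?; _∪?_)

-- Indicators, finite sums and counting

𝟙 : ∀ {p} {P : Set p} → Dec P → ℕ
𝟙 (yes _) = 1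
𝟙 (no _) = 0

𝟙-mono : ∀ {p q} {P : Set p} {Q : Set q} (p? : Dec P) (q? : Dec Q) → (P → Q) → 𝟙 p? ≤ 𝟙 q?
𝟙-mono (yes p) (yes _) _ = ≤-refl
𝟙-mono (yes p) (no ¬q) f = contradiction (f p) ¬q
𝟙-mono (no _) _ _ = z≤n

𝟙-⊎ : ∀ {p q r} {P : Set p} {Q : Set q} {R : Set r} (p? : Dec P) (q? : Dec Q) (r? : Dec R) →
      (P → Q ⊎ R) → 𝟙 p? ≤ 𝟙 q? + 𝟙 r?
𝟙-⊎ (no _) _ _ _ = z≤n
𝟙-⊎ (yes p) q? r? f with f p
... | inj₁ q = ≤-trans (𝟙-mono (yes p) q? (λ _ → q)) (m≤m+n _ _)
... | inj₂ r = ≤-trans (𝟙-mono (yes p) r? (λ _ → r)) (m≤n+m _ _)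

𝟙-no : ∀ {p} {P : Set p} (p? : Dec P) → ¬ P → 𝟙 p? ≡ 0
𝟙-no (yes p) ¬p = contradiction p ¬p
𝟙-no (no _) _ = refl

𝟙-yes : ∀ {p} {P : Set p} (p? : Dec P) → P → 𝟙 p? ≡ 1
𝟙-yes (yes _) _ = refl
𝟙-yes (no ¬p) p = contradiction p ¬p

≤-+-penalty : ∀ {p} {P : Set p} (p? : Dec P) {m n k} → (P → m ≤ n) → m ≤ n + k →
              m ≤ n + k * 𝟙 (¬? p?)
≤-+-penalty (yes p) m≤n _ = ≤-trans (m≤n p) (m≤m+n _ _)
≤-+-penalty (no _) {m} {n} {k} _ m≤n+k = subst (λ j → m ≤ n + j) (sym (*-identityʳ k)) m≤n+k

module _ {a} {A : Set a} where

  sumOver : List A → (A → ℕ) → ℕ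
  sumOver L f = sum (map f L)

  syntax sumOver L (λ x → e) = ∑[ x ∈ L ] e

  ∑-cong : ∀ L {f g : A → ℕ} → (∀ x → f x ≡ g x) → ∑[ x ∈ L ] f x ≡ ∑[ x ∈ L ] g x
  ∑-cong L f≗g = cong sum (map-cong f≗g L)

  ∑-mono-∈ : ∀ L {f g : A → ℕ} → (∀ {x} → x ∈ L → f x ≤ g x) →
             ∑[ x ∈ L ] f x ≤ ∑[ x ∈ L ] g x
  ∑-mono-∈ [] _ = z≤n
  ∑-mono-∈ (x ∷ L) f≤g = +-mono-≤ (f≤g (here refl)) (∑-mono-∈ L (f≤g ∘ there))

  ∑-mono : ∀ L {f g : A → ℕ} → (∀ x → f x ≤ g x) → ∑[ x ∈ L ] f x ≤ ∑[ x ∈ L ] g x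
  ∑-mono L f≤g = ∑-mono-∈ L (λ {x} _ → f≤g x)

  ∑-+ : ∀ L (f g : A → ℕ) → ∑[ x ∈ L ] (f x + g x) ≡ ∑[ x ∈ L ] f x + ∑[ x ∈ L ] g x
  ∑-+ [] f g = refl
  ∑-+ (x ∷ L) f g = begin
    f x + g x + (∑[ y ∈ L ] (f y + g y)) ≡⟨ cong (f x + g x +_) (∑-+ L f g) ⟩
    f x + g x + (∑[ y ∈ L ] f y + ∑[ y ∈ L ] g y) ≡⟨ +-comm-middle (f x) (g x) _ _ ⟩
    f x + ∑[ y ∈ L ] f y + (g x + ∑[ y ∈ L ] g y) ∎
    where
    open ≡-Reasoning
    +-comm-middle : ∀ a b c d → a + b + (c + d) ≡ a + c + (b + d)
    +-comm-middle = solve-∀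

  ∑-*ˡ : ∀ L c (f : A → ℕ) → ∑[ x ∈ L ] (c * f x) ≡ c * ∑[ x ∈ L ] f x
  ∑-*ˡ [] c f = sym (*-zeroʳ c)
  ∑-*ˡ (x ∷ L) c f = trans (cong (c * f x +_) (∑-*ˡ L c f)) (sym (*-distribˡ-+ c (f x) _))

  ∑-zero : ∀ L {f : A → ℕ} → (∀ x → f x ≡ 0) → ∑[ x ∈ L ] f x ≡ 0
  ∑-zero L f≗0 = trans (∑-cong L f≗0) (∑-*ˡ L 0 (λ _ → 0))

  ∑-const : ∀ L c → ∑[ x ∈ L ] c ≡ length L * c
  ∑-const [] c = refl
  ∑-const (x ∷ L) c = cong (c +_) (∑-const L c)

  ∑-+-≤ : ∀ L {f g : A → ℕ} {a b} → ∑[ x ∈ L ] f x ≤ a → ∑[ x ∈ L ] g x ≤ b →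
          ∑[ x ∈ L ] (f x + g x) ≤ a + b
  ∑-+-≤ L ∑f≤a ∑g≤b = ≤-trans (≤-reflexive (∑-+ L _ _)) (+-mono-≤ ∑f≤a ∑g≤b)

  ∑-term : ∀ {L x} (f : A → ℕ) → x ∈ L → f x ≤ ∑[ y ∈ L ] f y
  ∑-term {x ∷ L} f (here refl) = m≤m+n (f x) _
  ∑-term {y ∷ L} f (there x∈L) = ≤-trans (∑-term f x∈L) (m≤n+m _ (f y))

  ∃-below-average : ∀ x xs (f : A → ℕ) → Σ A λ a → length (x ∷ xs) * f a ≤ ∑[ y ∈ x ∷ xs ] f y
  ∃-below-average x [] f = x , ≤-reflexive (cong (f x +_) (sym (*-zeroˡ (f x))))
  ∃-below-average x (y ∷ ys) f with ∃-below-average y ys f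
  ... | a , avg with f x ≤? f a
  ...   | yes fx≤fa = x , +-monoʳ-≤ (f x) (≤-trans (*-monoʳ-≤ (length (y ∷ ys)) fx≤fa) avg)
  ...   | no fx≰fa = a , +-mono-≤ (<⇒≤ (≰⇒> fx≰fa)) avg

module _ {a b} {A : Set a} {B : Set b} where

  ∑-comm : ∀ (L : List A) (M : List B) (f : A → B → ℕ) →
           ∑[ x ∈ L ] ∑[ y ∈ M ] f x y ≡ ∑[ y ∈ M ] ∑[ x ∈ L ] f x y
  ∑-comm [] M f = sym (∑-zero M (λ _ → refl))
  ∑-comm (x ∷ L) M f = trans (cong (∑[ y ∈ M ] f x y +_) (∑-comm L M f))
                             (sym (∑-+ M (f x) (λ y → ∑[ x′ ∈ L ] f x′ y)))

count : ∀ {a p} {A : Set a} {P : Pred A p} → List A → Decidable P → ℕ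
count L P? = ∑[ x ∈ L ] 𝟙 (P? x)

module _ {a p} {A : Set a} {P : Pred A p} where

  count-mono : ∀ {q} {Q : Pred A q} L (P? : Decidable P) (Q? : Decidable Q) →
               P ⊆ Q → count L P? ≤ count L Q?
  count-mono L P? Q? P⊆Q = ∑-mono L (λ x → 𝟙-mono (P? x) (Q? x) P⊆Q)

  count-mono-∈ : ∀ {q} {Q : Pred A q} L (P? : Decidable P) (Q? : Decidable Q) →
                 (∀ {x} → x ∈ L → P x → Q x) → count L P? ≤ count L Q?
  count-mono-∈ L P? Q? P⊆Q = ∑-mono-∈ L (λ x∈L → 𝟙-mono (P? _) (Q? _) (P⊆Q x∈L))

  count-none : ∀ L (P? : Decidable P) → (∀ x → ¬ P x) → count L P? ≡ 0
  count-none L P? ¬P = ∑-zero L (λ x → 𝟙-no (P? x) (¬P x))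

count-∪ : ∀ {a q r} {A : Set a} {Q : Pred A q} {R : Pred A r} L
          (Q? : Decidable Q) (R? : Decidable R) {k l} →
          count L Q? ≤ k → count L R? ≤ l → count L (Q? ∪? R?) ≤ k + l
count-∪ L Q? R? #Q≤a #R≤b = ≤-trans (∑-mono L (λ x → 𝟙-⊎ ((Q? ∪? R?) x) (Q? x) (R? x) id))
                                   (≤-trans (≤-reflexive (∑-+ L _ _)) (+-mono-≤ #Q≤a #R≤b))

∑-allFin-suc : ∀ {n} (f : Fin (suc n) → ℕ) →
               ∑[ w ∈ allFin (suc n) ] f w ≡ f zero + ∑[ w ∈ allFin n ] f (suc w)
∑-allFin-suc f = cong (λ L → f zero + sum L)
  (trans (map-tabulate suc f) (sym (map-tabulate id (f ∘ suc))))

∑-allFin-const : ∀ n c → ∑[ w ∈ allFin n ] c ≡ n * c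
∑-allFin-const n c = trans (∑-const (allFin n) c) (cong (_* c) (length-tabulate {n = n} id))

count-unique : ∀ {n p} {P : Pred (Fin n) p} (P? : Decidable P) →
               (∀ {w w′} → P w → P w′ → w ≡ w′) → count (allFin n) P? ≤ 1
count-unique {zero} P? unique = z≤n
count-unique {suc n} P? unique rewrite ∑-allFin-suc (λ w → 𝟙 (P? w)) with P? zero
... | yes p = ≤-reflexive (cong suc (count-none (allFin n) (P? ∘ suc)
                (λ w p′ → Fin.0≢1+n (unique p p′))))
... | no ¬p = count-unique (P? ∘ suc) (λ p p′ → Fin.suc-injective (unique p p′))

∃-below-average-Fin : ∀ {n} → 1 ≤ n → (f : Fin n → ℕ) →
                      Σ (Fin n) λ a → n * f a ≤ ∑[ w ∈ allFin n ] f w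
∃-below-average-Fin {suc n} _ f
  with a , avg ← ∃-below-average zero (tabulate suc) f
  = a , subst (λ k → k * f a ≤ ∑[ w ∈ allFin (suc n) ] f w) (length-tabulate {n = suc n} id) avg

-- A penalty of T + 1 at u forces the below-average point away from u.
∃-below-average-avoiding : ∀ {n} → 2 ≤ n → (u : Fin n) (f : Fin n → ℕ) (T : ℕ) →
                           ∑[ w ∈ allFin n ] f w ≤ T →
                           Σ (Fin n) λ v → v ≢ u × n * f v ≤ T + suc T
∃-below-average-avoiding {n} 2≤n u f T ∑f≤T =
  let v , avg = ∃-below-average-Fin (≤-trans (s≤s z≤n) 2≤n) g
  in v , v≢u v avg , ≤-trans (*-monoʳ-≤ n (m≤m+n (f v) _)) (≤-trans avg ∑g≤)
  where
  g : Fin n → ℕ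
  g w = f w + suc T * 𝟙 (w Fin.≟ u)

  ∑g≤ : ∑[ w ∈ allFin n ] g w ≤ T + suc T
  ∑g≤ = begin
    ∑[ w ∈ allFin n ] g w
      ≡⟨ ∑-+ (allFin n) f _ ⟩
    ∑[ w ∈ allFin n ] f w + ∑[ w ∈ allFin n ] (suc T * 𝟙 (w Fin.≟ u))
      ≡⟨ cong (∑[ w ∈ allFin n ] f w +_) (∑-*ˡ (allFin n) (suc T) _) ⟩
    ∑[ w ∈ allFin n ] f w + suc T * count (allFin n) (Fin._≟ u)
      ≤⟨ +-mono-≤ ∑f≤T (*-monoʳ-≤ (suc T)
           (count-unique (Fin._≟ u) (λ w≡u w′≡u → trans w≡u (sym w′≡u)))) ⟩
    T + suc T * 1
      ≡⟨ cong (T +_) (*-identityʳ (suc T)) ⟩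
    T + suc T ∎
    where open ≤-Reasoning

  v≢u : ∀ v → n * g v ≤ ∑[ w ∈ allFin n ] g w → v ≢ u
  v≢u v avg refl = <-irrefl refl (≤-<-trans (≤-trans penalty avg) (≤-<-trans ∑g≤ T+1+T<2[1+T]))
    where
    T+1+T<2[1+T] : T + suc T < 2 * suc T
    T+1+T<2[1+T] = subst (T + suc T <_) (cong (suc T +_) (sym (+-identityʳ (suc T))))
                     (+-monoˡ-< (suc T) (n<1+n T))
    penalty : 2 * suc T ≤ n * g u
    penalty = *-mono-≤ 2≤n (≤-trans (≤-reflexive (trans (sym (*-identityʳ (suc T)))
                (cong (suc T *_) (sym (𝟙-yes (u Fin.≟ u) refl))))) (m≤n+m _ (f u)))

-- Labels near the ends of blocks

labels : ℕ → List ℕ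
labels = applyDownFrom suc

∈-labels⁻ : ∀ {x E} → x ∈ labels E → 1 ≤ x × x ≤ E
∈-labels⁻ x∈ with i , i<E , refl ← ∈-applyDownFrom⁻ suc x∈ = s≤s z≤n , i<E

∈-labels⁺ : ∀ {x E} → 1 ≤ x → x ≤ E → x ∈ labels E
∈-labels⁺ {suc i} _ x≤E = ∈-applyDownFrom⁺ suc x≤E

count-above : ∀ k c → count (labels k) (c <?_) ≤ k ∸ c
count-above zero c = z≤n
count-above (suc k) c with c <? suc k
... | yes (s≤s c≤k) = ≤-trans (s≤s (count-above k c)) (≤-reflexive (sym (+-∸-assoc 1 c≤k)))
... | no _ = ≤-trans (count-above k c) (∸-monoˡ-≤ c (n≤1+n k))

m∸[m∸n]≤n : ∀ m n → m ∸ (m ∸ n) ≤ n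
m∸[m∸n]≤n m n with ≤-total n m
... | inj₁ n≤m = ≤-reflexive (m∸[m∸n]≡n n≤m)
... | inj₂ m≤n rewrite m≤n⇒m∸n≡0 m≤n = m≤n

count-window : ∀ P E {q} {Q : Pred ℕ q} (Q? : Decidable Q) → 1 ≤ P →
  (∀ {x x′} → 1 ≤ x → x < x′ → x′ ≤ E → Q x → Q x′ → x′ < x + P) →
  count (labels E) Q? ≤ P
count-window P zero Q? _ close = z≤n
count-window P (suc E) Q? 1≤P close with Q? (suc E)
... | no _ = count-window P E Q? 1≤P (λ 1≤x x<x′ x′≤E → close 1≤x x<x′ (m≤n⇒m≤1+n x′≤E))
count-window (suc P′) (suc E) {Q = Q} Q? _ close | yes q = s≤s (begin
  count (labels E) Q?            ≤⟨ count-mono-∈ (labels E) Q? (E ∸ P′ <?_) near-top ⟩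
  count (labels E) (E ∸ P′ <?_)  ≤⟨ count-above E (E ∸ P′) ⟩
  E ∸ (E ∸ P′)                   ≤⟨ m∸[m∸n]≤n E P′ ⟩
  P′                             ∎)
  where
  open ≤-Reasoning
  near-top : ∀ {x} → x ∈ labels E → Q x → E ∸ P′ < x
  near-top {x} x∈ qx with 1≤x , x≤E ← ∈-labels⁻ x∈ =
    m<n+o⇒m∸n<o E P′ {{>-nonZero 1≤x}}
      (s≤s⁻¹ (subst (suc E <_) (trans (+-suc x P′) (cong suc (+-comm x P′)))
                    (close 1≤x (s≤s x≤E) ≤-refl qx q)))

module _ {m : ℕ} (blk : ℕ → Fin m) where

  count-by-blocks : ∀ P E {q} {Q : Pred ℕ q} (Q? : Decidable Q) → 1 ≤ P →
    (∀ {x x′} → 1 ≤ x → x < x′ → x′ ≤ E → blk x ≡ blk x′ → Q x → Q x′ → x′ < x + P) →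
    count (labels E) Q? ≤ m * P
  count-by-blocks P E {Q = Q} Q? 1≤P close = begin
    count (labels E) Q?
      ≤⟨ ∑-mono (labels E) (λ x → ≤-trans (𝟙-mono (Q? x) (inBlock? (blk x) x) (refl ,_))
                                          (∑-term (λ i → 𝟙 (inBlock? i x)) (∈-allFin (blk x)))) ⟩
    ∑[ x ∈ labels E ] ∑[ i ∈ allFin m ] 𝟙 (inBlock? i x)
      ≡⟨ ∑-comm (labels E) (allFin m) (λ x i → 𝟙 (inBlock? i x)) ⟩
    ∑[ i ∈ allFin m ] count (labels E) (inBlock? i)
      ≤⟨ ∑-mono (allFin m) (λ i → count-window P E (inBlock? i) 1≤P
           (λ 1≤x x<x′ x′≤E (i≡x , qx) (i≡x′ , qx′) →
              close 1≤x x<x′ x′≤E (trans (sym i≡x) i≡x′) qx qx′)) ⟩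
    ∑[ i ∈ allFin m ] P
      ≡⟨ ∑-allFin-const m P ⟩
    m * P ∎
    where
    open ≤-Reasoning
    inBlock? : ∀ i x → Dec (i ≡ blk x × Q x)
    inBlock? i x = (i Fin.≟ blk x) ×-dec Q? x

  NearBlockEnd : ℕ → ℕ → Pred ℕ 0ℓ
  NearBlockEnd E P x = E < x + P ⊎ blk x ≢ blk (x + P)

  nearBlockEnd? : ∀ E P → Decidable (NearBlockEnd E P)
  nearBlockEnd? E P x = (E <? x + P) ⊎-dec ¬? (blk x Fin.≟ blk (x + P))

  NearBlockStart : ℕ → Pred ℕ 0ℓ
  NearBlockStart P x = x ≤ P ⊎ blk (x ∸ P) ≢ blk x

  nearBlockStart? : ∀ P → Decidable (NearBlockStart P)
  nearBlockStart? P x = (x ≤? P) ⊎-dec ¬? (blk (x ∸ P) Fin.≟ blk x)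

  module _ {n : ℕ} (interval : IntervalPartition n m blk) {P : ℕ} (1≤P : 1 ≤ P) where

    count-nearBlockEnd : count (labels (ε n)) (nearBlockEnd? (ε n) P) ≤ m * P
    count-nearBlockEnd = count-by-blocks P (ε n) (nearBlockEnd? (ε n) P) 1≤P close
      where
      close : ∀ {x x′} → 1 ≤ x → x < x′ → x′ ≤ ε n → blk x ≡ blk x′ →
              NearBlockEnd (ε n) P x → NearBlockEnd (ε n) P x′ → x′ < x + P
      close {x} {x′} 1≤x x<x′ x′≤E same near _ with x′ <? x + P
      ... | yes x′<x+P = x′<x+P
      ... | no x′≮x+P with near
      ...   | inj₁ E<x+P = contradiction (≤-trans (≮⇒≥ x′≮x+P) x′≤E) (<⇒≱ E<x+P)
      ...   | inj₂ leaves = contradiction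
                (sym (interval x (x + P) x′ 1≤x (m≤m+n x P) (≮⇒≥ x′≮x+P) x′≤E same)) leaves

    count-nearBlockStart : count (labels (ε n)) (nearBlockStart? P) ≤ m * P
    count-nearBlockStart = count-by-blocks P (ε n) (nearBlockStart? P) 1≤P close
      where
      close : ∀ {x x′} → 1 ≤ x → x < x′ → x′ ≤ ε n → blk x ≡ blk x′ →
              NearBlockStart P x → NearBlockStart P x′ → x′ < x + P
      close {x} {x′} 1≤x x<x′ x′≤E same _ near with x′ <? x + P
      ... | yes x′<x+P = x′<x+P
      ... | no x′≮x+P with near
      ...   | inj₁ x′≤P = contradiction (≤-trans (+-monoˡ-≤ P 1≤x) (≮⇒≥ x′≮x+P)) (<⇒≱ (s≤s x′≤P))
      ...   | inj₂ enters = contradiction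
                (trans (interval x (x′ ∸ P) x′ 1≤x x≤x′∸P (m∸n≤m x′ P) x′≤E same) same) enters
        where
        x≤x′∸P : x ≤ x′ ∸ P
        x≤x′∸P = subst (_≤ x′ ∸ P) (m+n∸n≡m x P) (∸-monoˡ-≤ P (≮⇒≥ x′≮x+P))

-- Labels at a vertex

module LabelsAt {n : ℕ} (t : Labeling n) where

  wt-pos : ∀ {w v} → w ≢ v → 1 ≤ wt t w v
  wt-pos {w} {v} w≢v with Fin.<-cmp w v
  ... | tri< _ _ _ = proj₁ (range t _)
  ... | tri≈ _ w≡v _ = contradiction w≡v w≢v
  ... | tri> _ _ _ = proj₁ (range t _)

  wt≤ε : ∀ w v → wt t w v ≤ ε n
  wt≤ε w v with Fin.<-cmp w v
  ... | tri< _ _ _ = proj₂ (range t _)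
  ... | tri≈ _ _ _ = z≤n
  ... | tri> _ _ _ = proj₂ (range t _)

  Joins : Fin n → Fin n → Edge n → Set
  Joins w v e = proj₁ e ≡ (w , v) ⊎ proj₁ e ≡ (v , w)

  wt-edge : ∀ w v → 1 ≤ wt t w v → Σ (Edge n) λ e → lab t e ≡ wt t w v × Joins w v e
  wt-edge w v 1≤wt with Fin.<-cmp w v
  ... | tri< w<v _ _ = ((w , v) , w<v) , refl , inj₁ refl
  ... | tri≈ _ _ _ = contradiction 1≤wt λ ()
  ... | tri> _ _ v<w = ((v , w) , v<w) , refl , inj₂ refl

  Joins⇒Incident : ∀ {w v} e → Joins w v e → Incident v e
  Joins⇒Incident _ (inj₁ e≡wv) = inj₂ (,-injectiveʳ e≡wv)
  Joins⇒Incident _ (inj₂ e≡vw) = inj₁ (,-injectiveˡ e≡vw)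

  wt-injective : ∀ {w v w′ v′} → 1 ≤ wt t w v → wt t w v ≡ wt t w′ v′ →
                 (w ≡ w′ × v ≡ v′) ⊎ (w ≡ v′ × v ≡ w′)
  wt-injective {w} {v} {w′} {v′} 1≤wt same
    with e , le , joins ← wt-edge w v 1≤wt
       | e′ , le′ , joins′ ← wt-edge w′ v′ (subst (1 ≤_) same 1≤wt)
    with e≡e′ ← inj t e e′ (trans le (trans same (sym le′)))
    with joins | joins′
  ... | inj₁ p | inj₁ q = inj₁ (,-injective (trans (sym p) (trans e≡e′ q)))
  ... | inj₁ p | inj₂ q = inj₂ (,-injective (trans (sym p) (trans e≡e′ q)))
  ... | inj₂ p | inj₁ q = inj₂ (swap (,-injective (trans (sym p) (trans e≡e′ q))))
  ... | inj₂ p | inj₂ q = inj₁ (swap (,-injective (trans (sym p) (trans e≡e′ q))))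

  lab-cong : ∀ (e e′ : Edge n) → proj₁ e ≡ proj₁ e′ → lab t e ≡ lab t e′
  lab-cong (ij , p) (.ij , q) refl = cong (λ r → lab t (ij , r)) (Fin.<-irrelevant p q)

  infix 4 _∈S_
  _∈S_ : ℕ → Fin n → Set
  x ∈S v = 1 ≤ x × ∃ λ w → wt t w v ≡ x

  _∈S?_ : ∀ x v → Dec (x ∈S v)
  x ∈S? v = (1 ≤? x) ×-dec any? (λ w → wt t w v ≟ x)

  wt∈S : ∀ {w v} → w ≢ v → wt t w v ∈S v
  wt∈S {w} w≢v = wt-pos w≢v , w , refl

  ∈S⇒≤ε : ∀ {x v} → x ∈S v → x ≤ ε n
  ∈S⇒≤ε (_ , w , refl) = wt≤ε w _

  count-wt≡ : ∀ x v → 1 ≤ x → count (allFin n) (λ w → wt t w v ≟ x) ≤ 1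
  count-wt≡ x v 1≤x = count-unique (λ w → wt t w v ≟ x) same-end
    where
    same-end : ∀ {w w′} → wt t w v ≡ x → wt t w′ v ≡ x → w ≡ w′
    same-end wt≡x wt′≡x with wt-injective (subst (1 ≤_) (sym wt≡x) 1≤x) (trans wt≡x (sym wt′≡x))
    ... | inj₁ (w≡w′ , _) = w≡w′
    ... | inj₂ (w≡v , v≡w′) = trans w≡v v≡w′

  count-∈S≤2 : ∀ x → count (allFin n) (x ∈S?_) ≤ 2
  count-∈S≤2 x with any? (x ∈S?_)
  ... | no none =
    ≤-trans (≤-reflexive (count-none (allFin n) (x ∈S?_) (λ v x∈v → none (v , x∈v)))) z≤n
  ... | yes (v₀ , 1≤x , w₀ , wt≡x) = begin
    count (allFin n) (x ∈S?_)
      ≤⟨ count-mono (allFin n) (x ∈S?_) ((Fin._≟ v₀) ∪? (Fin._≟ w₀)) endpoint ⟩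
    count (allFin n) ((Fin._≟ v₀) ∪? (Fin._≟ w₀))
      ≤⟨ count-∪ (allFin n) (Fin._≟ v₀) (Fin._≟ w₀)
                 (count-unique (Fin._≟ v₀) unique) (count-unique (Fin._≟ w₀) unique) ⟩
    2 ∎
    where
    open ≤-Reasoning
    endpoint : ∀ {v} → x ∈S v → v ≡ v₀ ⊎ v ≡ w₀
    endpoint {v} (_ , w , wt≡x′)
      with wt-injective {w} {v} (subst (1 ≤_) (sym wt≡x′) 1≤x) (trans wt≡x′ (sym wt≡x))
    ... | inj₁ (_ , v≡v₀) = inj₁ v≡v₀
    ... | inj₂ (_ , v≡w₀) = inj₂ v≡w₀
    unique : ∀ {a v v′ : Fin n} → v ≡ a → v′ ≡ a → v ≡ v′
    unique v≡a v′≡a = trans v≡a (sym v′≡a)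

  count-pairs-labelled : ∀ x → 1 ≤ x →
    ∑[ v ∈ allFin n ] count (allFin n) (λ w → wt t w v ≟ x) ≤ 2
  count-pairs-labelled x 1≤x = ≤-trans (∑-mono (allFin n) at-most-one-if-∈S) (count-∈S≤2 x)
    where
    at-most-one-if-∈S : ∀ v → count (allFin n) (λ w → wt t w v ≟ x) ≤ 𝟙 (x ∈S? v)
    at-most-one-if-∈S v with x ∈S? v
    ... | yes _ = count-wt≡ x v 1≤x
    ... | no x∉v = ≤-reflexive
      (count-none (allFin n) (λ w → wt t w v ≟ x) (λ w wt≡x → x∉v (1≤x , w , wt≡x)))

  ∑-pairs≤2∑-labels : ∀ (g : ℕ → ℕ) → g 0 ≡ 0 →
    ∑[ v ∈ allFin n ] ∑[ w ∈ allFin n ] g (wt t w v) ≤ 2 * ∑[ x ∈ labels (ε n) ] g x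
  ∑-pairs≤2∑-labels g g0≡0 = begin
    ∑[ v ∈ allFin n ] ∑[ w ∈ allFin n ] g (wt t w v)
      ≤⟨ ∑-mono (allFin n) (λ v → ∑-mono (allFin n) (λ w → spread (wt t w v) (wt≤ε w v))) ⟩
    ∑[ v ∈ allFin n ] ∑[ w ∈ allFin n ] ∑[ x ∈ L ] (g x * 𝟙 (wt t w v ≟ x))
      ≡⟨ ∑-cong (allFin n) (λ v → ∑-comm (allFin n) L _) ⟩
    ∑[ v ∈ allFin n ] ∑[ x ∈ L ] ∑[ w ∈ allFin n ] (g x * 𝟙 (wt t w v ≟ x))
      ≡⟨ ∑-comm (allFin n) L _ ⟩
    ∑[ x ∈ L ] ∑[ v ∈ allFin n ] ∑[ w ∈ allFin n ] (g x * 𝟙 (wt t w v ≟ x))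
      ≡⟨ ∑-cong L (λ x → trans (∑-cong (allFin n) (λ v → ∑-*ˡ (allFin n) (g x) _))
                               (∑-*ˡ (allFin n) (g x) _)) ⟩
    ∑[ x ∈ L ] (g x * ∑[ v ∈ allFin n ] count (allFin n) (λ w → wt t w v ≟ x))
      ≤⟨ ∑-mono-∈ L (λ {x} x∈L →
           *-monoʳ-≤ (g x) (count-pairs-labelled x (proj₁ (∈-labels⁻ x∈L)))) ⟩
    ∑[ x ∈ L ] (g x * 2)
      ≡⟨ trans (∑-cong L (λ x → *-comm (g x) 2)) (∑-*ˡ L 2 g) ⟩
    2 * ∑[ x ∈ L ] g x ∎
    where
    open ≤-Reasoning
    L = labels (ε n)
    spread : ∀ y → y ≤ ε n → g y ≤ ∑[ x ∈ L ] (g x * 𝟙 (y ≟ x))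
    spread zero _ = ≤-trans (≤-reflexive g0≡0) z≤n
    spread (suc y) y<ε = ≤-trans
      (≤-reflexive (trans (sym (*-identityʳ _))
                          (cong (g (suc y) *_) (sym (𝟙-yes (suc y ≟ suc y) refl)))))
      (∑-term (λ x → g x * 𝟙 (suc y ≟ x)) (∈-labels⁺ (s≤s z≤n) y<ε))

  count-positive-pairs : ∀ {q} {Q : Pred ℕ q} (Q? : Decidable Q) →
    ∑[ v ∈ allFin n ] count (allFin n) (λ w → (1 ≤? wt t w v) ×-dec Q? (wt t w v))
      ≤ 2 * count (labels (ε n)) Q?
  count-positive-pairs Q? =
    ≤-trans (∑-pairs≤2∑-labels (λ x → 𝟙 ((1 ≤? x) ×-dec Q? x)) refl)
            (*-monoʳ-≤ 2 (count-mono (labels (ε n)) (λ x → (1 ≤? x) ×-dec Q? x) Q? proj₂))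

  count-∈S-image : ∀ (f : ℕ → ℕ) u →
    ∑[ v ∈ allFin n ] count (allFin n) (λ w → f (wt t w u) ∈S? v) ≤ 2 * n
  count-∈S-image f u = begin
    ∑[ v ∈ allFin n ] count (allFin n) (λ w → f (wt t w u) ∈S? v)
      ≡⟨ ∑-comm (allFin n) (allFin n) (λ v w → 𝟙 (f (wt t w u) ∈S? v)) ⟩
    ∑[ w ∈ allFin n ] count (allFin n) (f (wt t w u) ∈S?_)
      ≤⟨ ∑-mono (allFin n) (λ w → count-∈S≤2 (f (wt t w u))) ⟩
    ∑[ w ∈ allFin n ] 2
      ≡⟨ trans (∑-allFin-const n 2) (*-comm n 2) ⟩
    2 * n ∎
    where open ≤-Reasoning

  count-∈S-preimage : ∀ c u →
    ∑[ v ∈ allFin n ] count (allFin n) (λ w → (wt t w v ∸ c) ∈S? u) ≤ 2 * n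
  count-∈S-preimage c u = begin
    ∑[ v ∈ allFin n ] count (allFin n) (λ w → (wt t w v ∸ c) ∈S? u)
      ≤⟨ ∑-mono (allFin n) (λ v → ∑-mono (allFin n) (λ w → traced (wt t w v))) ⟩
    ∑[ v ∈ allFin n ] ∑[ w ∈ allFin n ] ∑[ w″ ∈ allFin n ] 𝟙 (hit? w″ (wt t w v))
      ≡⟨ ∑-cong (allFin n) (λ v → ∑-comm (allFin n) (allFin n) _) ⟩
    ∑[ v ∈ allFin n ] ∑[ w″ ∈ allFin n ] ∑[ w ∈ allFin n ] 𝟙 (hit? w″ (wt t w v))
      ≡⟨ ∑-comm (allFin n) (allFin n) _ ⟩
    ∑[ w″ ∈ allFin n ] ∑[ v ∈ allFin n ] count (allFin n) (λ w → hit? w″ (wt t w v))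
      ≤⟨ ∑-mono (allFin n) hits≤2 ⟩
    ∑[ w″ ∈ allFin n ] 2
      ≡⟨ trans (∑-allFin-const n 2) (*-comm n 2) ⟩
    2 * n ∎
    where
    open ≤-Reasoning
    hit? : ∀ w″ y → Dec (1 ≤ wt t w″ u × y ≡ wt t w″ u + c)
    hit? w″ y = (1 ≤? wt t w″ u) ×-dec (y ≟ wt t w″ u + c)

    traced : ∀ y → 𝟙 ((y ∸ c) ∈S? u) ≤ ∑[ w″ ∈ allFin n ] 𝟙 (hit? w″ y)
    traced y with (y ∸ c) ∈S? u
    ... | no _ = z≤n
    ... | yes (1≤y∸c , w₀ , wt≡y∸c) =
      ≤-trans (≤-reflexive (sym (𝟙-yes (hit? w₀ y) (subst (1 ≤_) (sym wt≡y∸c) 1≤y∸c , y≡wt+c))))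
              (∑-term (λ w″ → 𝟙 (hit? w″ y)) (∈-allFin w₀))
      where
      c≤y : c ≤ y
      c≤y = <⇒≤ (m∸n≢0⇒n<m {y} {c} (λ y∸c≡0 → <⇒≢ 1≤y∸c (sym y∸c≡0)))
      y≡wt+c : y ≡ wt t w₀ u + c
      y≡wt+c = sym (trans (cong (_+ c) wt≡y∸c) (m∸n+n≡m c≤y))

    hits≤2 : ∀ w″ → ∑[ v ∈ allFin n ] count (allFin n) (λ w → hit? w″ (wt t w v)) ≤ 2
    hits≤2 w″ with 1 ≤? wt t w″ u + c
    ... | yes 1≤a+c = ≤-trans
      (∑-mono (allFin n) (λ v → count-mono (allFin n) _ (λ w → wt t w v ≟ wt t w″ u + c) proj₂))
      (count-pairs-labelled _ 1≤a+c)
    ... | no 1≰a+c = ≤-trans (≤-reflexive (∑-zero (allFin n) (λ v → count-none (allFin n)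
      (λ w → hit? w″ (wt t w v)) (λ w (1≤a , _) → 1≰a+c (≤-trans 1≤a (m≤m+n _ c)))))) z≤n

  module _ {m} {blk : ℕ → Fin m} (sep : Separated t blk) where

    ∈S-separated : ∀ {x y v} → x ∈S v → y ∈S v → x ≢ y → blk x ≢ blk y
    ∈S-separated {v = v} (1≤x , w , refl) (1≤y , w′ , refl) x≢y
      with e , le , joins ← wt-edge w v 1≤x | e′ , le′ , joins′ ← wt-edge w′ v 1≤y =
      subst₂ (λ a b → blk a ≢ blk b) le le′
        (sep v e e′ (Joins⇒Incident e joins) (Joins⇒Incident e′ joins′)
             (λ e≡e′ → x≢y (trans (sym le) (trans (lab-cong e e′ e≡e′) le′))))

-- Relabelling by an involutive shift

module _ {n : ℕ} (t : Labeling n) (π : ℕ → ℕ) (π-involutive : ∀ x → π (π x) ≡ x)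
         (π-range : ∀ {x} → 1 ≤ x → x ≤ ε n → 1 ≤ π x × π x ≤ ε n) where

  relabel : Labeling n
  relabel = record
    { lab = π ∘ lab t
    ; inj = λ e e′ same → inj t e e′ (trans (sym (π-involutive _)) (trans (cong π same) (π-involutive _)))
    ; range = λ e → π-range (proj₁ (range t e)) (proj₂ (range t e))
    ; onto = λ k 1≤k k≤ε → let (1≤πk , πk≤ε) = π-range 1≤k k≤ε
                               (e , le) = onto t (π k) 1≤πk πk≤ε
                           in e , trans (cong π le) (π-involutive k)
    }

  wt-relabel : π 0 ≡ 0 → ∀ w v → wt relabel w v ≡ π (wt t w v)
  wt-relabel π0≡0 w v with Fin.<-cmp w v
  ... | tri< _ _ _ = refl
  ... | tri≈ _ _ _ = sym π0≡0
  ... | tri> _ _ _ = refl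

module Shift {n : ℕ} (P : ℕ) {ℓ} {Up : Pred ℕ ℓ} (Up? : Decidable Up)
             (no-chain : ∀ {x} → Up x → ¬ Up (x + P))
             (Up-range : ∀ {x} → Up x → 1 ≤ x × x + P ≤ ε n) where

  Down : Pred ℕ ℓ
  Down y = P ≤ y × Up (y ∸ P)

  down? : Decidable Down
  down? y = (P ≤? y) ×-dec Up? (y ∸ P)

  shift : ℕ → ℕ
  shift x with Up? x | down? x
  ... | yes _ | _ = x + P
  ... | no _ | yes _ = x ∸ P
  ... | no _ | no _ = x

  Up⇒Down : ∀ {x} → Up x → Down (x + P)
  Up⇒Down {x} up = m≤n+m P x , subst Up (sym (m+n∸n≡m x P)) up

  Down⇒¬Up : ∀ {y} → Down y → ¬ Up y
  Down⇒¬Up (P≤y , up) = no-chain up ∘ subst Up (sym (m∸n+n≡m P≤y))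

  shift-up : ∀ {x} → Up x → shift x ≡ x + P
  shift-up {x} up with Up? x
  ... | yes _ = refl
  ... | no ¬up = contradiction up ¬up

  shift-down : ∀ {y} → Down y → shift y ≡ y ∸ P
  shift-down {y} down with Up? y | down? y
  ... | yes up | _ = contradiction up (Down⇒¬Up down)
  ... | no _ | yes _ = refl
  ... | no _ | no ¬down = contradiction down ¬down

  shift-id : ∀ {x} → ¬ Up x → ¬ Down x → shift x ≡ x
  shift-id {x} ¬up ¬down with Up? x | down? x
  ... | yes up | _ = contradiction up ¬up
  ... | no _ | yes down = contradiction down ¬down
  ... | no _ | no _ = refl

  data Move (x : ℕ) : Set ℓ where
    up   : Up x → Move x
    down : Down x → Move x
    stay : ¬ Up x → ¬ Down x → Move x

  move : ∀ x → Move x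
  move x with Up? x | down? x
  ... | yes u | _ = up u
  ... | no _ | yes d = down d
  ... | no ¬u | no ¬d = stay ¬u ¬d

  shift-involutive : ∀ x → shift (shift x) ≡ x
  shift-involutive x with move x
  ... | up u = begin
    shift (shift x)  ≡⟨ cong shift (shift-up u) ⟩
    shift (x + P)    ≡⟨ shift-down (Up⇒Down u) ⟩
    x + P ∸ P        ≡⟨ m+n∸n≡m x P ⟩
    x                ∎
    where open ≡-Reasoning
  ... | down d@(P≤x , u) = begin
    shift (shift x)  ≡⟨ cong shift (shift-down d) ⟩
    shift (x ∸ P)    ≡⟨ shift-up u ⟩
    x ∸ P + P        ≡⟨ m∸n+n≡m P≤x ⟩
    x                ∎
    where open ≡-Reasoning
  ... | stay ¬u ¬d = trans (cong shift (shift-id ¬u ¬d)) (shift-id ¬u ¬d)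

  shift-displacement : ∀ x → ∣ x - shift x ∣ ≤ P
  shift-displacement x with move x
  ... | up u rewrite shift-up u = ≤-reflexive (∣m-m+n∣≡n x P)
  ... | down d rewrite shift-down d =
    ≤-trans (≤-reflexive (m≤n⇒∣n-m∣≡n∸m (m∸n≤m x P))) (m∸[m∸n]≤n x P)
  ... | stay ¬u ¬d rewrite shift-id ¬u ¬d = ≤-trans (≤-reflexive (∣n-n∣≡0 x)) z≤n

  shift-range : ∀ {x} → 1 ≤ x → x ≤ ε n → 1 ≤ shift x × shift x ≤ ε n
  shift-range {x} 1≤x x≤ε with move x
  ... | up u rewrite shift-up u = ≤-trans 1≤x (m≤m+n x P) , proj₂ (Up-range u)
  ... | down d@(_ , u) rewrite shift-down d = proj₁ (Up-range u) , ≤-trans (m∸n≤m x P) x≤ε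
  ... | stay ¬u ¬d rewrite shift-id ¬u ¬d = 1≤x , x≤ε

  shift-zero : shift 0 ≡ 0
  shift-zero = shift-id (λ u → contradiction (proj₁ (Up-range u)) λ ())
                        (λ (_ , u) → contradiction (subst (1 ≤_) (0∸n≡0 P) (proj₁ (Up-range u))) λ ())

  shift-gain : ∀ x → x + P ≤ shift x + (P + P) * 𝟙 (∁? Up? x)
  shift-gain x = ≤-+-penalty (Up? x) (λ u → ≤-reflexive (sym (shift-up u))) (begin
    x + P             ≤⟨ +-monoˡ-≤ P (≤-trans (m≤n+∣m-n∣ x (shift x))
                                               (+-monoʳ-≤ (shift x) (shift-displacement x))) ⟩
    shift x + P + P   ≡⟨ +-assoc (shift x) P P ⟩
    shift x + (P + P) ∎)
    where open ≤-Reasoning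

  shift-loss : ∀ y → shift y + P ≤ y + (P + P) * 𝟙 (∁? down? y)
  shift-loss y = ≤-+-penalty (down? y)
    (λ d → ≤-reflexive (trans (cong (_+ P) (shift-down d)) (m∸n+n≡m (proj₁ d)))) (begin
    shift y + P       ≤⟨ +-monoˡ-≤ P (≤-trans (m≤n+∣m-n∣ (shift y) y)
                           (+-monoʳ-≤ y (subst (_≤ P) (∣-∣-comm y (shift y)) (shift-displacement y)))) ⟩
    y + P + P         ≡⟨ +-assoc y P P ⟩
    y + (P + P)       ∎)
    where open ≤-Reasoning

  module _ (t : Labeling n) where

    shifted : Labeling n
    shifted = relabel t shift shift-involutive shift-range

    shifted-isSwap : IsSwap P t shifted
    shifted-isSwap e = shift-displacement (lab t e)

    s-shifted : ∀ v → s shifted v ≡ ∑[ w ∈ allFin n ] shift (wt t w v)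
    s-shifted v = ∑-cong (allFin n) (λ w → wt-relabel t shift shift-involutive shift-range shift-zero w v)

    s-gain : ∀ u → s t u + n * P ≤ s shifted u + (P + P) * count (allFin n) (λ w → ∁? Up? (wt t w u))
    s-gain u = begin
      s t u + n * P
        ≡⟨ cong (s t u +_) (sym (∑-allFin-const n P)) ⟩
      s t u + ∑[ w ∈ allFin n ] P
        ≡⟨ sym (∑-+ (allFin n) (λ w → wt t w u) (λ _ → P)) ⟩
      ∑[ w ∈ allFin n ] (wt t w u + P)
        ≤⟨ ∑-mono (allFin n) (λ w → shift-gain (wt t w u)) ⟩
      ∑[ w ∈ allFin n ] (shift (wt t w u) + (P + P) * 𝟙 (∁? Up? (wt t w u)))
        ≡⟨ ∑-+ (allFin n) _ _ ⟩
      ∑[ w ∈ allFin n ] shift (wt t w u) + ∑[ w ∈ allFin n ] ((P + P) * 𝟙 (∁? Up? (wt t w u)))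
        ≡⟨ cong₂ _+_ (sym (s-shifted u)) (∑-*ˡ (allFin n) (P + P) _) ⟩
      s shifted u + (P + P) * count (allFin n) (λ w → ∁? Up? (wt t w u)) ∎
      where open ≤-Reasoning

    s-loss : ∀ v → s shifted v + n * P ≤ s t v + (P + P) * count (allFin n) (λ w → ∁? down? (wt t w v))
    s-loss v = begin
      s shifted v + n * P
        ≡⟨ cong₂ _+_ (s-shifted v) (sym (∑-allFin-const n P)) ⟩
      ∑[ w ∈ allFin n ] shift (wt t w v) + ∑[ w ∈ allFin n ] P
        ≡⟨ sym (∑-+ (allFin n) _ _) ⟩
      ∑[ w ∈ allFin n ] (shift (wt t w v) + P)
        ≤⟨ ∑-mono (allFin n) (λ w → shift-loss (wt t w v)) ⟩
      ∑[ w ∈ allFin n ] (wt t w v + (P + P) * 𝟙 (∁? down? (wt t w v)))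
        ≡⟨ ∑-+ (allFin n) _ _ ⟩
      s t v + ∑[ w ∈ allFin n ] ((P + P) * 𝟙 (∁? down? (wt t w v)))
        ≡⟨ cong (s t v +_) (∑-*ˡ (allFin n) (P + P) _) ⟩
      s t v + (P + P) * count (allFin n) (λ w → ∁? down? (wt t w v)) ∎
      where open ≤-Reasoning

-- The swap for a pair of vertices

module PairSwap {n m : ℕ} (t : Labeling n) (blk : ℕ → Fin m) (sep : Separated t blk)
                {P : ℕ} (1≤P : 1 ≤ P) (u v : Fin n) where
  open LabelsAt t

  Free : ℕ → Set
  Free x = ¬ x ∈S u × ¬ x ∈S v

  free? : Decidable Free
  free? x = ¬? (x ∈S? u) ×-dec ¬? (x ∈S? v)

  Raise : ℕ → Set
  Raise x = x ∈S u × ¬ x ∈S v × x + P ≤ ε n × Free (x + P)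

  raise? : Decidable Raise
  raise? x = x ∈S? u ×-dec ¬? (x ∈S? v) ×-dec x + P ≤? ε n ×-dec free? (x + P)

  Sink : ℕ → Set
  Sink x = 1 ≤ x × Free x × (x + P) ∈S v × ¬ (x + P) ∈S u × ¬ Raise (x ∸ P)

  sink? : Decidable Sink
  sink? x = 1 ≤? x ×-dec free? x ×-dec (x + P) ∈S? v ×-dec ¬? ((x + P) ∈S? u)
                   ×-dec ¬? (raise? (x ∸ P))

  -- Up x: the labels x and x + P trade places, either because x is a label of u that moves up
  -- to a free slot (Raise) or because x + P is a label of v that moves down to a free slot (Sink).
  Up : ℕ → Set
  Up x = Raise x ⊎ Sink x

  up? : Decidable Up
  up? x = raise? x ⊎-dec sink? x

  no-chain : ∀ {x} → Up x → ¬ Up (x + P)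
  no-chain (inj₁ (_ , _ , _ , x+P∉u , _)) (inj₁ (x+P∈u , _)) = x+P∉u x+P∈u
  no-chain {x} (inj₁ raise) (inj₂ (_ , _ , _ , _ , ¬raise)) =
    ¬raise (subst Raise (sym (m+n∸n≡m x P)) raise)
  no-chain (inj₂ (_ , _ , _ , x+P∉u , _)) (inj₁ (x+P∈u , _)) = x+P∉u x+P∈u
  no-chain (inj₂ (_ , _ , x+P∈v , _ , _)) (inj₂ (_ , (_ , x+P∉v) , _)) = x+P∉v x+P∈v

  Up-range : ∀ {x} → Up x → 1 ≤ x × x + P ≤ ε n
  Up-range (inj₁ ((1≤x , _) , _ , x+P≤ε , _)) = 1≤x , x+P≤ε
  Up-range (inj₂ (1≤x , _ , x+P∈v , _)) = 1≤x , ∈S⇒≤ε x+P∈v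

  open Shift {n} P up? no-chain Up-range public

  obstructed-at-u : ∀ w → ¬ Up (wt t w u) →
    w ≡ u ⊎ wt t w u ∈S v ⊎ (1 ≤ wt t w u × NearBlockEnd blk (ε n) P (wt t w u)) ⊎
    (wt t w u + P) ∈S v
  obstructed-at-u w ¬up with w Fin.≟ u
  ... | yes w≡u = inj₁ w≡u
  ... | no w≢u with x ← wt t w u | x∈u ← wt∈S w≢u
                  | x ∈S? v | x + P ≤? ε n | (x + P) ∈S? u | (x + P) ∈S? v
  ...   | yes x∈v | _ | _ | _ = inj₂ (inj₁ x∈v)
  ...   | no _ | no x+P≰ε | _ | _ = inj₂ (inj₂ (inj₁ (proj₁ x∈u , inj₁ (≰⇒> x+P≰ε))))
  ...   | no _ | yes _ | yes x+P∈u | _ = inj₂ (inj₂ (inj₁ (proj₁ x∈u ,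
          inj₂ (∈S-separated sep x∈u x+P∈u (<⇒≢ (m<m+n x 1≤P))))))
  ...   | no _ | yes _ | no _ | yes x+P∈v = inj₂ (inj₂ (inj₂ x+P∈v))
  ...   | no x∉v | yes x+P≤ε | no x+P∉u | no x+P∉v =
          contradiction (inj₁ (x∈u , x∉v , x+P≤ε , x+P∉u , x+P∉v)) ¬up

  obstructed-at-v : ∀ w → ¬ Down (wt t w v) →
    w ≡ v ⊎ wt t w v ∈S u ⊎ (1 ≤ wt t w v × NearBlockStart blk P (wt t w v)) ⊎
    (wt t w v ∸ P) ∈S u ⊎ (wt t w v ∸ (P + P)) ∈S u
  obstructed-at-v w ¬down with w Fin.≟ v
  ... | yes w≡v = inj₁ w≡v
  ... | no w≢v with y ← wt t w v | y∈v ← wt∈S w≢v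
                  | y ∈S? u | P <? y | (y ∸ P) ∈S? u | (y ∸ P) ∈S? v | raise? (y ∸ P ∸ P)
  ...   | yes y∈u | _ | _ | _ | _ = inj₂ (inj₁ y∈u)
  ...   | no _ | no P≮y | _ | _ | _ = inj₂ (inj₂ (inj₁ (proj₁ y∈v , inj₁ (≮⇒≥ P≮y))))
  ...   | no _ | yes _ | yes z∈u | _ | _ = inj₂ (inj₂ (inj₂ (inj₁ z∈u)))
  ...   | no _ | yes P<y | no _ | yes z∈v | _ = inj₂ (inj₂ (inj₁ (proj₁ y∈v ,
          inj₂ (∈S-separated sep z∈v y∈v (<⇒≢ (∸-monoʳ-< {o = 0} 1≤P (<⇒≤ P<y)))))))
  ...   | no _ | yes _ | no _ | no _ | yes (z∸P∈u , _) =
          inj₂ (inj₂ (inj₂ (inj₂ (subst (_∈S u) (∸-+-assoc y P P) z∸P∈u))))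
  ...   | no y∉u | yes P<y | no z∉u | no z∉v | no ¬raise =
          contradiction (<⇒≤ P<y , inj₂ sink) ¬down
    where
    z+P≡y : y ∸ P + P ≡ y
    z+P≡y = m∸n+n≡m (<⇒≤ P<y)
    sink : Sink (y ∸ P)
    sink = m<n⇒0<n∸m P<y , (z∉u , z∉v) , subst (_∈S v) (sym z+P≡y) y∈v ,
           subst (λ x → ¬ x ∈S u) (sym z+P≡y) y∉u , ¬raise

record SeparatingSwap {n : ℕ} (t : Labeling n) (m P : ℕ) : Set where
  field
    u v : Fin n
    t′ : Labeling n
    obstructions : ℕ
    u≢v : u ≢ v
    isSwap : IsSwap P t t′
    few-obstructions : n * obstructions ≤ 6 * (m * P) + 23 * n
    gap : s t u + s t′ v + 2 * (n * P) ≤ s t′ u + s t v + (P + P) * obstructions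

module _ {n m : ℕ} (t : Labeling n) {blk : ℕ → Fin m} (interval : IntervalPartition n m blk)
         (sep : Separated t blk) {P : ℕ} (1≤P : 1 ≤ P) where
  open LabelsAt t

  nearEndLabels : Fin n → ℕ
  nearEndLabels u = count (allFin n) (λ w → (1 ≤? wt t w u) ×-dec nearBlockEnd? blk (ε n) P (wt t w u))

  nearStartLabels : Fin n → ℕ
  nearStartLabels v = count (allFin n) (λ w → (1 ≤? wt t w v) ×-dec nearBlockStart? blk P (wt t w v))

  collisions : Fin n → Fin n → ℕ
  collisions u v =
    count (allFin n) (λ w → wt t w u ∈S? v) + (count (allFin n) (λ w → (wt t w u + P) ∈S? v) +
    (count (allFin n) (λ w → wt t w v ∈S? u) + (count (allFin n) (λ w → (wt t w v ∸ P) ∈S? u) +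
     count (allFin n) (λ w → (wt t w v ∸ (P + P)) ∈S? u))))

  obstruction-count : ∀ u v → let open PairSwap t blk sep 1≤P u v in
    count (allFin n) (λ w → ∁? up? (wt t w u)) + count (allFin n) (λ w → ∁? down? (wt t w v))
      ≤ 2 + (nearEndLabels u + (nearStartLabels v + collisions u v))
  obstruction-count u v = begin
    count L (λ w → ∁? up? (wt t w u)) + count L (λ w → ∁? down? (wt t w v))
      ≤⟨ +-mono-≤ (count-mono L _ (at? u ∪? (c₁? ∪? (end? ∪? c₂?))) (obstructed-at-u _))
                  (count-mono L _ (at? v ∪? (c₃? ∪? (start? ∪? (c₄? ∪? c₅?)))) (obstructed-at-v _)) ⟩
    count L (at? u ∪? (c₁? ∪? (end? ∪? c₂?))) +
    count L (at? v ∪? (c₃? ∪? (start? ∪? (c₄? ∪? c₅?))))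
      ≤⟨ +-mono-≤ (count-∪ L (at? u) _ (at≤1 u)
                     (count-∪ L c₁? _ ≤-refl (count-∪ L end? c₂? ≤-refl ≤-refl)))
                  (count-∪ L (at? v) _ (at≤1 v) (count-∪ L c₃? _ ≤-refl
                     (count-∪ L start? _ ≤-refl (count-∪ L c₄? c₅? ≤-refl ≤-refl)))) ⟩
    (1 + (#c₁ + (#end + #c₂))) + (1 + (#c₃ + (#start + (#c₄ + #c₅))))
      ≡⟨ regroup #c₁ #end #c₂ #c₃ #start #c₄ #c₅ ⟩
    2 + (#end + (#start + (#c₁ + (#c₂ + (#c₃ + (#c₄ + #c₅)))))) ∎
    where
    open ≤-Reasoning
    open PairSwap t blk sep 1≤P u v
    L : List (Fin n)
    L = allFin n
    at? : ∀ a → Decidable (_≡ a)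
    at? a w = w Fin.≟ a
    at≤1 : ∀ a → count L (at? a) ≤ 1
    at≤1 a = count-unique (at? a) (λ w≡a w′≡a → trans w≡a (sym w′≡a))
    c₁? : Decidable λ w → wt t w u ∈S v
    c₁? w = wt t w u ∈S? v
    c₂? : Decidable λ w → (wt t w u + P) ∈S v
    c₂? w = (wt t w u + P) ∈S? v
    c₃? : Decidable λ w → wt t w v ∈S u
    c₃? w = wt t w v ∈S? u
    c₄? : Decidable λ w → (wt t w v ∸ P) ∈S u
    c₄? w = (wt t w v ∸ P) ∈S? u
    c₅? : Decidable λ w → (wt t w v ∸ (P + P)) ∈S u
    c₅? w = (wt t w v ∸ (P + P)) ∈S? u
    end? : Decidable λ w → 1 ≤ wt t w u × NearBlockEnd blk (ε n) P (wt t w u)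
    end? w = (1 ≤? wt t w u) ×-dec nearBlockEnd? blk (ε n) P (wt t w u)
    start? : Decidable λ w → 1 ≤ wt t w v × NearBlockStart blk P (wt t w v)
    start? w = (1 ≤? wt t w v) ×-dec nearBlockStart? blk P (wt t w v)
    #c₁ #c₂ #c₃ #c₄ #c₅ #end #start : ℕ
    #c₁ = count L c₁?
    #c₂ = count L c₂?
    #c₃ = count L c₃?
    #c₄ = count L c₄?
    #c₅ = count L c₅?
    #end = count L end?
    #start = count L start?
    regroup : ∀ a e b c s d f → (1 + (a + (e + b))) + (1 + (c + (s + (d + f))))
                               ≡ 2 + (e + (s + (a + (b + (c + (d + f))))))
    regroup = solve-∀

  ∑-nearEndLabels : ∑[ u ∈ allFin n ] nearEndLabels u ≤ 2 * (m * P)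
  ∑-nearEndLabels = ≤-trans (count-positive-pairs (nearBlockEnd? blk (ε n) P))
                            (*-monoʳ-≤ 2 (count-nearBlockEnd blk {n} interval 1≤P))

  budget : ℕ
  budget = 2 * (m * P) + (2 * n + (2 * n + (2 * n + (2 * n + 2 * n))))

  ∑-nearStartLabels+collisions : ∀ u → ∑[ v ∈ allFin n ] (nearStartLabels v + collisions u v) ≤ budget
  ∑-nearStartLabels+collisions u =
    ∑-+-≤ L (≤-trans (count-positive-pairs (nearBlockStart? blk P))
                     (*-monoʳ-≤ 2 (count-nearBlockStart blk {n} interval 1≤P)))
    (∑-+-≤ L (count-∈S-image (λ x → x) u)
    (∑-+-≤ L (count-∈S-image (_+ P) u)
    (∑-+-≤ L (count-∈S-preimage 0 u)
    (∑-+-≤ L (count-∈S-preimage P u) (count-∈S-preimage (P + P) u)))))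
    where
    L : List (Fin n)
    L = allFin n

  separating-swap-at : ∀ u v → u ≢ v → n * nearEndLabels u ≤ 2 * (m * P) →
    n * (nearStartLabels v + collisions u v) ≤ budget + suc budget → SeparatingSwap t m P
  separating-swap-at u v u≢v u-avg v-avg = record
    { u = u ; v = v ; t′ = shifted t ; obstructions = b ; u≢v = u≢v
    ; isSwap = shifted-isSwap t ; few-obstructions = b-bound ; gap = gap }
    where
    open PairSwap t blk sep 1≤P u v
    #¬up #¬down b : ℕ
    #¬up = count (allFin n) (λ w → ∁? up? (wt t w u))
    #¬down = count (allFin n) (λ w → ∁? down? (wt t w v))
    b = #¬up + #¬down

    b-bound : n * b ≤ 6 * (m * P) + 23 * n
    b-bound = begin
      n * b
        ≤⟨ *-monoʳ-≤ n (obstruction-count u v) ⟩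
      n * (2 + (nearEndLabels u + (nearStartLabels v + collisions u v)))
        ≡⟨ distribute n (nearEndLabels u) (nearStartLabels v + collisions u v) ⟩
      2 * n + (n * nearEndLabels u + n * (nearStartLabels v + collisions u v))
        ≤⟨ +-monoʳ-≤ (2 * n) (+-mono-≤ u-avg v-avg) ⟩
      2 * n + (2 * (m * P) + (budget + suc budget))
        ≡⟨ tally n (m * P) ⟩
      6 * (m * P) + 22 * n + 1
        ≤⟨ +-monoʳ-≤ (6 * (m * P) + 22 * n) 1≤n ⟩
      6 * (m * P) + 22 * n + n
        ≡⟨ absorb n (m * P) ⟩
      6 * (m * P) + 23 * n ∎
      where
      open ≤-Reasoning
      1≤n : 1 ≤ n
      1≤n = ≤-trans (s≤s z≤n) (Fin.toℕ<n u)
      distribute : ∀ n a r → n * (2 + (a + r)) ≡ 2 * n + (n * a + n * r)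
      distribute = solve-∀
      tally : ∀ n q → 2 * n + (2 * q + ((2 * q + (2 * n + (2 * n + (2 * n + (2 * n + 2 * n)))))
                        + suc (2 * q + (2 * n + (2 * n + (2 * n + (2 * n + 2 * n)))))))
                      ≡ 6 * q + 22 * n + 1
      tally = solve-∀
      absorb : ∀ n q → 6 * q + 22 * n + n ≡ 6 * q + 23 * n
      absorb = solve-∀

    gap : s t u + s (shifted t) v + 2 * (n * P) ≤ s (shifted t) u + s t v + (P + P) * b
    gap = begin
      s t u + s (shifted t) v + 2 * (n * P)
        ≡⟨ pair-up (s t u) (s (shifted t) v) (n * P) ⟩
      (s t u + n * P) + (s (shifted t) v + n * P)
        ≤⟨ +-mono-≤ (s-gain t u) (s-loss t v) ⟩
      (s (shifted t) u + (P + P) * #¬up) + (s t v + (P + P) * #¬down)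
        ≡⟨ collect (s (shifted t) u) (s t v) (P + P) #¬up #¬down ⟩
      s (shifted t) u + s t v + (P + P) * b ∎
      where
      open ≤-Reasoning
      pair-up : ∀ a c d → a + c + 2 * d ≡ (a + d) + (c + d)
      pair-up = solve-∀
      collect : ∀ a c k x y → (a + k * x) + (c + k * y) ≡ a + c + k * (x + y)
      collect = solve-∀

  exists-separating-swap : 2 ≤ n → SeparatingSwap t m P
  exists-separating-swap 2≤n =
    let u , u-avg = ∃-below-average-Fin (≤-trans (s≤s z≤n) 2≤n) nearEndLabels
        v , v≢u , v-avg = ∃-below-average-avoiding 2≤n u (λ v → nearStartLabels v + collisions u v)
                            budget (∑-nearStartLabels+collisions u)
    in separating-swap-at u v (v≢u ∘ sym) (≤-trans u-avg ∑-nearEndLabels) v-avg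

-- Asymptotics

Eventually : (ℕ → Set) → Set
Eventually Q = ∃ λ N → ∀ n → N ≤ n → Q n

module _ {Q R : ℕ → Set} where

  eventually-× : Eventually Q → Eventually R → Eventually (λ n → Q n × R n)
  eventually-× (N₁ , q) (N₂ , r) =
    N₁ + N₂ , λ n N≤n → q n (≤-trans (m≤m+n N₁ N₂) N≤n) , r n (≤-trans (m≤n+m N₂ N₁) N≤n)

  eventually-map : (∀ {n} → Q n → R n) → Eventually Q → Eventually R
  eventually-map f (N , q) = N , λ n N≤n → f (q n N≤n)

eventually-≥ : ∀ c → Eventually (c ≤_)
eventually-≥ c = c , λ _ c≤n → c≤n

frequently : ∀ {Q : ℕ → Set} → Eventually Q → ∀ N → ∃ λ n → N ≤ n × Q n
frequently (N₀ , q) N = N + N₀ , m≤m+n N N₀ , q (N + N₀) (m≤n+m N₀ N)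

∣m-n∣≤o : ∀ {m n o} → m ≤ n + o → n ≤ m + o → ∣ m - n ∣ ≤ o
∣m-n∣≤o {m} {n} {o} m≤n+o n≤m+o with ∣m-n∣≡[m∸n]∨[n∸m] m n
... | inj₁ ∣m-n∣≡m∸n = subst (_≤ o) (sym ∣m-n∣≡m∸n) (m≤n+o⇒m∸n≤o m n m≤n+o)
... | inj₂ ∣m-n∣≡n∸m = subst (_≤ o) (sym ∣m-n∣≡n∸m) (m≤n+o⇒m∸n≤o n m n≤m+o)

∣m-n∣≤o⇒n≤m+o : ∀ {m n o} → ∣ m - n ∣ ≤ o → n ≤ m + o
∣m-n∣≤o⇒n≤m+o {m} {n} ∣m-n∣≤o =
  ≤-trans (m≤n+∣m-n∣ n m) (+-monoʳ-≤ m (subst (_≤ _) (∣-∣-comm m n) ∣m-n∣≤o))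

scaled-gap : ∀ k {a c X Y} → c + Y ≤ a + X → suc k * X ≤ Y → k * Y ≤ suc k * ∣ a - c ∣
scaled-gap k {a} {c} {X} {Y} c+Y≤a+X [k+1]X≤Y = begin
  k * Y                 ≡⟨ sym (m+n∸m≡n Y (k * Y)) ⟩
  suc k * Y ∸ Y         ≤⟨ ∸-monoʳ-≤ (suc k * Y) [k+1]X≤Y ⟩
  suc k * Y ∸ suc k * X ≡⟨ sym (*-distribˡ-∸ (suc k) Y X) ⟩
  suc k * (Y ∸ X)       ≤⟨ *-monoʳ-≤ (suc k) (≤-trans Y∸X≤a∸c (m∸n≤∣m-n∣ a c)) ⟩
  suc k * ∣ a - c ∣     ∎
  where
  open ≤-Reasoning
  Y∸X≤a∸c : Y ∸ X ≤ a ∸ c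
  Y∸X≤a∸c = m≤n+o⇒m∸n≤o Y X (+-cancelˡ-≤ c Y (X + (a ∸ c)) (begin
    c + Y             ≤⟨ c+Y≤a+X ⟩
    a + X             ≤⟨ +-monoˡ-≤ X (m≤n+m∸n a c) ⟩
    c + (a ∸ c) + X   ≡⟨ +-assoc c (a ∸ c) X ⟩
    c + ((a ∸ c) + X) ≡⟨ cong (c +_) (+-comm (a ∸ c) X) ⟩
    c + (X + (a ∸ c)) ∎))

module _ {n : ℕ} {P : ℕ} {t t′ : Labeling n} (θ : IsSwap P t t′) where

  wt-drift : ∀ w v → wt t′ w v ≤ wt t w v + P
  wt-drift w v with Fin.<-cmp w v
  ... | tri< _ _ _ = ∣m-n∣≤o⇒n≤m+o (θ _)
  ... | tri≈ _ _ _ = z≤n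
  ... | tri> _ _ _ = ∣m-n∣≤o⇒n≤m+o (θ _)

  s-drift : ∀ v → s t′ v ≤ s t v + n * P
  s-drift v = begin
    s t′ v                                    ≤⟨ ∑-mono (allFin n) (λ w → wt-drift w v) ⟩
    ∑[ w ∈ allFin n ] (wt t w v + P)          ≡⟨ ∑-+ (allFin n) (λ w → wt t w v) (λ _ → P) ⟩
    s t v + ∑[ w ∈ allFin n ] P               ≡⟨ cong (s t v +_) (∑-allFin-const n P) ⟩
    s t v + n * P                             ∎
    where open ≤-Reasoning

IsSwap-sym : ∀ {n P} {t t′ : Labeling n} → IsSwap P t t′ → IsSwap P t′ t
IsSwap-sym {t = t} {t′} θ e = subst (_≤ _) (∣-∣-comm (lab t e) (lab t′ e)) (θ e)

swap-spread : ∀ {n α P} {t t′ : Labeling n} → AlmostSupermagic α t → IsSwap P t t′ →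
              ∀ u v → ∣ s t′ u - s t′ v ∣ ≤ 2 * P * n + α
swap-spread {n} {α} {P} {t} {t′} magic θ u v = ∣m-n∣≤o (drift u v) (drift v u)
  where
  drift : ∀ x y → s t′ x ≤ s t′ y + (2 * P * n + α)
  drift x y = begin
    s t′ x                      ≤⟨ s-drift θ x ⟩
    s t x + n * P               ≤⟨ +-monoˡ-≤ (n * P) (∣m-n∣≤o⇒n≤m+o (magic y x)) ⟩
    s t y + α + n * P           ≤⟨ +-monoˡ-≤ (n * P)
                                      (+-monoˡ-≤ α (s-drift (IsSwap-sym {t = t} {t′} θ) y)) ⟩
    s t′ y + n * P + α + n * P  ≡⟨ regroup (s t′ y) n P α ⟩
    s t′ y + (2 * P * n + α)    ∎
    where
    open ≤-Reasoning
    regroup : ∀ z n P α → z + n * P + α + n * P ≡ z + (2 * P * n + α)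
    regroup = solve-∀

separated-gap : ∀ {n α P b} {t t′ : Labeling n} {u v} → AlmostSupermagic α t →
  s t u + s t′ v + 2 * (n * P) ≤ s t′ u + s t v + (P + P) * b →
  s t′ v + 2 * P * n ≤ s t′ u + ((P + P) * b + α)
separated-gap {n} {α} {P} {b} {t} {t′} {u} {v} magic gap = +-cancelˡ-≤ (s t u) _ _ (begin
  s t u + (s t′ v + 2 * P * n)          ≡⟨ regroupˡ (s t u) (s t′ v) n P ⟩
  s t u + s t′ v + 2 * (n * P)          ≤⟨ gap ⟩
  s t′ u + s t v + (P + P) * b          ≤⟨ +-monoˡ-≤ ((P + P) * b)
                                             (+-monoʳ-≤ (s t′ u) (∣m-n∣≤o⇒n≤m+o (magic u v))) ⟩
  s t′ u + (s t u + α) + (P + P) * b    ≡⟨ regroupʳ (s t′ u) (s t u) α ((P + P) * b) ⟩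
  s t u + (s t′ u + ((P + P) * b + α))  ∎)
  where
  open ≤-Reasoning
  regroupˡ : ∀ a c n P → a + (c + 2 * P * n) ≡ a + c + 2 * (n * P)
  regroupˡ = solve-∀
  regroupʳ : ∀ a c α e → a + (c + α) + e ≡ c + (a + (e + α))
  regroupʳ = solve-∀

obstruction-error : ∀ k {n P q b a} → n * b ≤ 6 * q + 23 * n → 24 * suc k * q ≤ n * n →
  92 * suc k ≤ n → suc k * a ≤ P * n → suc k * ((P + P) * b + a) ≤ 2 * P * n
obstruction-error k {n} {P} {q} {b} {a} nb≤ q-small n-large [k+1]a≤Pn = begin
  suc k * ((P + P) * b + a)      ≡⟨ expand k P b a ⟩
  P * (2 * suc k * b) + suc k * a ≤⟨ +-mono-≤ (*-monoʳ-≤ P [2k+2]b≤n) [k+1]a≤Pn ⟩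
  P * n + P * n                  ≡⟨ double P n ⟩
  2 * P * n                      ∎
  where
  open ≤-Reasoning
  expand : ∀ k P b a → suc k * ((P + P) * b + a) ≡ P * (2 * suc k * b) + suc k * a
  expand = solve-∀
  double : ∀ x y → x * y + x * y ≡ 2 * x * y
  double = solve-∀
  pull : ∀ k n b → 2 * (n * (2 * suc k * b)) ≡ 4 * suc k * (n * b)
  pull = solve-∀
  push : ∀ k q n → 4 * suc k * (6 * q + 23 * n) ≡ 24 * suc k * q + 92 * suc k * n
  push = solve-∀
  [2k+2]b≤n : 2 * suc k * b ≤ n
  [2k+2]b≤n = *-cancelˡ-≤ n {{>-nonZero (≤-trans (s≤s z≤n) n-large)}} (*-cancelˡ-≤ 2 (begin
    2 * (n * (2 * suc k * b))         ≡⟨ pull k n b ⟩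
    4 * suc k * (n * b)               ≤⟨ *-monoʳ-≤ (4 * suc k) nb≤ ⟩
    4 * suc k * (6 * q + 23 * n)      ≡⟨ push k q n ⟩
    24 * suc k * q + 92 * suc k * n   ≤⟨ +-mono-≤ q-small (*-monoˡ-≤ n n-large) ⟩
    n * n + n * n                     ≡⟨ cong (n * n +_) (sym (+-identityʳ (n * n))) ⟩
    2 * (n * n)                       ∎))

α-negligible : ∀ {α p : ℕ → ℕ} → BigOn α → TendsToInfinity p →
               ∀ k → Eventually (λ n → suc k * α n ≤ p n * n)
α-negligible {α} {p} (C , α≤Cn) p→∞ k =
  eventually-map bound (eventually-× α≤Cn (p→∞ (suc k * C)))
  where
  bound : ∀ {n} → α n ≤ C * n × suc k * C ≤ p n → suc k * α n ≤ p n * n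
  bound {n} (α≤Cn , [k+1]C≤p) = begin
    suc k * α n     ≤⟨ *-monoʳ-≤ (suc k) α≤Cn ⟩
    suc k * (C * n) ≡⟨ sym (*-assoc (suc k) C n) ⟩
    suc k * C * n   ≤⟨ *-monoˡ-≤ n [k+1]C≤p ⟩
    p n * n         ∎
    where open ≤-Reasoning

small-spread : ∀ {n α P} {t t′ : Labeling n} → AlmostSupermagic α t → IsSwap P t t′ →
  ∀ k → suc k * α ≤ P * n → ∀ u v → suc k * ∣ s t′ u - s t′ v ∣ ≤ (2 + k) * (2 * P * n)
small-spread {n} {α} {P} {t′ = t′} magic θ k [k+1]α≤Pn u v = begin
  suc k * ∣ s t′ u - s t′ v ∣           ≤⟨ *-monoʳ-≤ (suc k) (swap-spread magic θ u v) ⟩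
  suc k * (2 * P * n + α)               ≡⟨ *-distribˡ-+ (suc k) (2 * P * n) α ⟩
  suc k * (2 * P * n) + suc k * α       ≤⟨ +-monoʳ-≤ (suc k * (2 * P * n)) [k+1]α≤Pn ⟩
  suc k * (2 * P * n) + P * n           ≤⟨ +-monoʳ-≤ (suc k * (2 * P * n)) (*-monoˡ-≤ n (m≤m+n P _)) ⟩
  suc k * (2 * P * n) + 2 * P * n       ≡⟨ +-comm (suc k * (2 * P * n)) (2 * P * n) ⟩
  (2 + k) * (2 * P * n)                 ∎
  where open ≤-Reasoning

large-spread : ∀ {n m α P} (t : Labeling n) {blk : ℕ → Fin m} → IntervalPartition n m blk →
  Separated t blk → AlmostSupermagic α t → ∀ k → suc k * α ≤ P * n → 1 ≤ P →
  24 * suc k * (m * P) ≤ n * n → 92 * suc k ≤ n →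
  Σ (Labeling n) λ t′ → IsSwap P t t′ ×
    Σ (Fin n) λ u → Σ (Fin n) λ v → u ≢ v × k * (2 * P * n) ≤ suc k * ∣ s t′ u - s t′ v ∣
large-spread {n} {m} {α} {P} t interval sep magic k [k+1]α≤Pn 1≤P mP-small n-large =
  conclude (exists-separating-swap t interval sep 1≤P 2≤n)
  where
  2≤n : 2 ≤ n
  2≤n = ≤-trans (≤-trans (m≤m+n 2 90) (m≤m*n 92 (suc k))) n-large
  conclude : SeparatingSwap t m P → Σ (Labeling n) λ t′ → IsSwap P t t′ ×
    Σ (Fin n) λ u → Σ (Fin n) λ v → u ≢ v × k * (2 * P * n) ≤ suc k * ∣ s t′ u - s t′ v ∣
  conclude σ = t′ , isSwap , u , v , u≢v ,
    scaled-gap k {s t′ u} {s t′ v} (separated-gap {P = P} magic gap)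
      (obstruction-error k {P = P} few-obstructions mP-small n-large [k+1]α≤Pn)
    where open SeparatingSwap σ

lemma5p1 : (α p m : ℕ → ℕ) (t : (n : ℕ) → Labeling n)
    (blk : (n : ℕ) → ℕ → Fin (m n)) →
    BigOn α →
    Admissible p →
    (∀ n → AlmostSupermagic (α n) (t n)) →
    LittleOn²/p m p →
    (∀ n → IntervalPartition n (m n) (blk n)) →
    (∀ n → Separated (t n) (blk n)) →
    LimsupIsOne p t
lemma5p1 α p m t blk α-linear (_ , p→∞) magic m-small interval sep =
  (λ k → eventually-map (λ {n} [k+1]α≤pn t′ θ u v _ → small-spread (magic n) θ k [k+1]α≤pn u v)
                        (α-negligible α-linear p→∞ k)) ,
  (λ k → frequently (eventually-map
           (λ {n} (([k+1]α≤pn , 1≤p) , mp-small , n-large) →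
              large-spread (t n) (interval n) (sep n) (magic n) k [k+1]α≤pn 1≤p
                (subst (_≤ n * n) (*-assoc (24 * suc k) (m n) (p n)) mp-small) n-large)
           (conditions k)))
  where
  conditions : ∀ k → Eventually λ n → (suc k * α n ≤ p n * n × 1 ≤ p n) ×
                                      (24 * suc k * m n * p n ≤ n * n × 92 * suc k ≤ n)
  conditions k = eventually-× (eventually-× (α-negligible α-linear p→∞ k) (p→∞ 1))
                              (eventually-× (m-small (24 * suc k)) (eventually-≥ (92 * suc k)))
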